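{- Let $G$ be a proper simple game with $n$ players. If $G$ has a winning coalition consisting of two players, then $G$ is roughly weighted.
   Context: A simple game is $(P,W)$ with $P=[n]$, $W\subseteq 2^P$ (winning coalitions) closed under supersets within $P$, $W\ne\emptyset$, $W\ne 2^P$; other coalitions are losing. It is proper if $X\in W$ implies $P\setminus X\notin W$. It is roughly weighted if there exist non-negative reals $w_1,\dots,w_n$ and a real $q$, not all zero, such that $\sum_{i\in X}w_i<q$ implies $X$ losing and $\sum_{i\in X}w_i>q$ implies $X$ winning. -}

module Defs where

open import Data.Nat using (ℕ; zero; suc)
open import Data.Bool using (Bool; true; false)
open import Data.Fin using (Fin; zero; suc)
open import Data.Fin.Subset using (Subset; _⊆_; ∁; _∪_; ⁅_⁆)
open import Data.Vec using (_∷_; [])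
open import Data.Rational using (ℚ; 0ℚ; _+_; _<_; _≤_; _>_)
open import Data.Product using (Σ; ∃; ∃-syntax; _×_)
open import Relation.Binary.PropositionalEquality using (_≡_; _≢_)
open import Relation.Nullary using (¬_)

-- A simple game on players P = Fin n: the set W of winning coalitions is
-- given by its (Bool-valued) characteristic function on Subset n = 2^P.
record SimpleGame (n : ℕ) : Set where
  field
    win      : Subset n → Bool
    monotone : ∀ X Y → X ⊆ Y → win X ≡ true → win Y ≡ true
    nonempty : ∃[ X ] win X ≡ true
    notAll   : ∃[ X ] win X ≡ false

open SimpleGame public

Proper : ∀ {n} → SimpleGame n → Set
Proper G = ∀ X → win G X ≡ true → win G (∁ X) ≡ false

weight : ∀ {n} → (Fin n → ℚ) → Subset n → ℚ
weight {zero}  w []            = 0ℚ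
weight {suc n} w (true  ∷ X) = w zero + weight (λ i → w (suc i)) X
weight {suc n} w (false ∷ X) = weight (λ i → w (suc i)) X

RoughlyWeighted : ∀ {n} → SimpleGame n → Set
RoughlyWeighted {n} G =
  Σ (Fin n → ℚ) λ w → Σ ℚ λ q →
    (∀ i → 0ℚ ≤ w i)
    × ¬ ((∀ i → w i ≡ 0ℚ) × q ≡ 0ℚ)
    × (∀ X → weight w X < q → win G X ≡ false)
    × (∀ X → weight w X > q → win G X ≡ true)

HasWinningPair : ∀ {n} → SimpleGame n → Set
HasWinningPair {n} G =
  Σ (Fin n) λ i → Σ (Fin n) λ j → i ≢ j × win G (⁅ i ⁆ ∪ ⁅ j ⁆) ≡ true

-- Give the two players of the winning pair weight 1, everybody else weight 0,
-- and take quota 1.  A coalition of weight above 1 contains the whole pair, so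
-- it wins by monotonicity.  A coalition of weight below 1 contains neither
-- player, so its complement contains the pair and wins, and by properness the
-- coalition itself loses.
module Submission where

open import Defs
open import Data.Nat using (ℕ; zero; suc)
open import Data.Bool using (true; false; if_then_else_)
open import Data.Bool.Properties using (¬-not; not-¬)
open import Data.Fin using (Fin; zero; suc; _≟_)
open import Data.Fin.Subset using (Subset; _⊆_; ∁; _∪_; ⁅_⁆; _∈_)
open import Data.Fin.Subset.Properties
  using (_∈?_; x∈p∪q⁻; x∈⁅y⁆⇒x≡y; x∈p⇒x∉∁p; x∉p⇒x∈∁p)
open import Data.Vec using (_∷_; [])
open import Data.Rational using (ℚ; 0ℚ; 1ℚ; _+_; _<_; _≤_; _>_)
open import Data.Rational.Properties
  using (positive⁻¹; +-identityˡ; +-0-commutativeMonoid; +-mono-≤; +-monoʳ-<; ≤-refl; <⇒≤; <-irrefl; <-asym; 1≢0)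
open import Data.Product using (_×_; _,_; proj₂)
open import Data.Sum using (inj₁; inj₂)
open import Data.Empty using (⊥-elim)
open import Function using (_∘_)
open import Relation.Nullary using (Dec; does; yes; no; ¬_)
open import Relation.Binary.PropositionalEquality
  using (_≡_; refl; sym; trans; cong; cong₂; subst)
open import Algebra.Bundles using (CommutativeMonoid)
open import Algebra.Properties.CommutativeSemigroup
  (CommutativeMonoid.commutativeSemigroup +-0-commutativeMonoid)
  using () renaming (interchange to +-interchange)

private
  variable
    n : ℕ
    A B : Set

iverson : Dec A → ℚ
iverson a? = if does a? then 1ℚ else 0ℚ

iverson-nonneg : (a? : Dec A) → 0ℚ ≤ iverson a?
iverson-nonneg (yes _) = <⇒≤ (positive⁻¹ 1ℚ)
iverson-nonneg (no _)  = ≤-refl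

-- Closed sums like 1ℚ + 0ℚ evaluate to their normal form, so refl relates them to 1ℚ.
iverson-+-<1 : (a? : Dec A) (b? : Dec B) → iverson a? + iverson b? < 1ℚ → ¬ A × ¬ B
iverson-+-<1 (yes _) (yes _) 2<1 = ⊥-elim (<-asym 2<1 (+-monoʳ-< 1ℚ (positive⁻¹ 1ℚ)))
iverson-+-<1 (yes _) (no _)  1<1 = ⊥-elim (<-irrefl refl 1<1)
iverson-+-<1 (no _)  (yes _) 1<1 = ⊥-elim (<-irrefl refl 1<1)
iverson-+-<1 (no ¬a) (no ¬b) _   = ¬a , ¬b

iverson-+->1 : (a? : Dec A) (b? : Dec B) → iverson a? + iverson b? > 1ℚ → A × B
iverson-+->1 (yes a) (yes b) _   = a , b
iverson-+->1 (yes _) (no _)  1>1 = ⊥-elim (<-irrefl refl 1>1)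
iverson-+->1 (no _)  (yes _) 1>1 = ⊥-elim (<-irrefl refl 1>1)
iverson-+->1 (no _)  (no _)  0>1 = ⊥-elim (<-asym 0>1 (positive⁻¹ 1ℚ))

δ : Fin n → Fin n → ℚ
δ i k = iverson (i ≟ k)

weight-0 : (X : Subset n) → weight (λ _ → 0ℚ) X ≡ 0ℚ
weight-0 []          = refl
weight-0 (true ∷ X)  = cong (0ℚ +_) (weight-0 X)
weight-0 (false ∷ X) = weight-0 X

weight-+ : (a b : Fin n → ℚ) (X : Subset n) →
           weight (λ k → a k + b k) X ≡ weight a X + weight b X
weight-+ a b []          = refl
weight-+ a b (false ∷ X) = weight-+ (a ∘ suc) (b ∘ suc) X
weight-+ a b (true ∷ X)  =
  trans (cong ((a zero + b zero) +_) (weight-+ (a ∘ suc) (b ∘ suc) X))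
        (+-interchange (a zero) (b zero) (weight (a ∘ suc) X) (weight (b ∘ suc) X))

weight-δ : (i : Fin n) (X : Subset n) → weight (δ i) X ≡ iverson (i ∈? X)
weight-δ zero    (true ∷ X)  = cong (1ℚ +_) (weight-0 X)
weight-δ zero    (false ∷ X) = weight-0 X
weight-δ (suc i) (true ∷ X)  = trans (+-identityˡ _) (weight-δ i X)
weight-δ (suc i) (false ∷ X) = weight-δ i X

⁅x⁆∪⁅y⁆⊆p : {x y : Fin n} {p : Subset n} → x ∈ p → y ∈ p → ⁅ x ⁆ ∪ ⁅ y ⁆ ⊆ p
⁅x⁆∪⁅y⁆⊆p {x = x} {y} x∈p y∈p z∈ with x∈p∪q⁻ ⁅ x ⁆ ⁅ y ⁆ z∈
... | inj₁ z∈⁅x⁆ = subst (_∈ _) (sym (x∈⁅y⁆⇒x≡y x z∈⁅x⁆)) x∈p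
... | inj₂ z∈⁅y⁆ = subst (_∈ _) (sym (x∈⁅y⁆⇒x≡y y z∈⁅y⁆)) y∈p

∁-winning⇒losing : (G : SimpleGame n) → Proper G →
                   ∀ X → win G (∁ X) ≡ true → win G X ≡ false
∁-winning⇒losing G proper X ∁X-wins =
  ¬-not λ X-wins → not-¬ (proper (∁ X) ∁X-wins) (monotone G X (∁ (∁ X)) p⊆∁∁p X-wins)
  where
  p⊆∁∁p : X ⊆ ∁ (∁ X)
  p⊆∁∁p = x∉p⇒x∈∁p ∘ x∈p⇒x∉∁p

pairWeight : Fin n → Fin n → Fin n → ℚ
pairWeight i j k = δ i k + δ j k

weight-pairWeight : (i j : Fin n) (X : Subset n) →
                    weight (pairWeight i j) X ≡ iverson (i ∈? X) + iverson (j ∈? X)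
weight-pairWeight i j X =
  trans (weight-+ (δ i) (δ j) X) (cong₂ _+_ (weight-δ i X) (weight-δ j X))

theorem15 : (n : ℕ) (G : SimpleGame n) → Proper G → HasWinningPair G → RoughlyWeighted G
theorem15 n G proper (i , j , _ , pair-wins) =
  pairWeight i j , 1ℚ , nonneg , 1≢0 ∘ proj₂ , below-loses , above-wins
  where
  nonneg : ∀ k → 0ℚ ≤ pairWeight i j k
  nonneg k = +-mono-≤ (iverson-nonneg (i ≟ k)) (iverson-nonneg (j ≟ k))

  below-loses : ∀ X → weight (pairWeight i j) X < 1ℚ → win G X ≡ false
  below-loses X below with iverson-+-<1 (i ∈? X) (j ∈? X)
                             (subst (_< 1ℚ) (weight-pairWeight i j X) below)
  ... | i∉X , j∉X = ∁-winning⇒losing G proper X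
    (monotone G (⁅ i ⁆ ∪ ⁅ j ⁆) (∁ X) (⁅x⁆∪⁅y⁆⊆p (x∉p⇒x∈∁p i∉X) (x∉p⇒x∈∁p j∉X)) pair-wins)

  above-wins : ∀ X → weight (pairWeight i j) X > 1ℚ → win G X ≡ true
  above-wins X above with iverson-+->1 (i ∈? X) (j ∈? X)
                            (subst (_> 1ℚ) (weight-pairWeight i j X) above)
  ... | i∈X , j∈X = monotone G (⁅ i ⁆ ∪ ⁅ j ⁆) X (⁅x⁆∪⁅y⁆⊆p i∈X j∈X) pair-wins
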